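{- Let $n=3$ and $\lambda=(2,1)$. There do not exist operators $e_i^K,f_i^K\colon\mathrm{SVT}^3(\lambda)\to\mathrm{SVT}^3(\lambda)\sqcup\{0\}$, $i\in\{1,2\}$, such that: $f_i^KT$ (when nonzero) is obtained from $T$ by adding an $i+1$ to some box; $e_i^KT'=T$ if and only if $f_i^KT=T'$; properties (K.1), (K.2), (K.3) hold; and (H.2) holds: if $e_iT\ne0$ or $f_iT=0$, then $f_i^KT=0$.
   Context: $\mathrm{SVT}^3(\lambda)$ is the set of semistandard set-valued tableaux of shape $\lambda=(2,1)$ (English convention) with entries in $\{1,2,3\}$: fillings of the boxes by nonempty sets such that every choice of one integer per box gives a semistandard tableau (rows weakly increasing, columns strictly increasing). $\mathrm{wt}(T)=(c_1,c_2,c_3)$ with $c_j$ the number of boxes containing $j$; $\mathrm{ex}(T)=\sum_{\text{boxes }A}(|A|-1)$. Let $u$ be the tableau with first row $\{1\},\{1\}$ and second row $\{2\}$. Fixed crystal operators $e_i,f_i$ ($i=1,2$): write $+$ above each column containing (in some box) $i$ but not $i+1$, $-$ above each column containing $i+1$ but not $i$; reading columns left to right, repeatedly delete adjacent pairs $-+$. If no $+$ remains, $f_iT=0$; otherwise let $\mathsf b$ be the box containing $i$ in the column of the rightmost remaining $+$ and $\mathsf b^\rightarrow$ the box immediately right; if $i\notin\mathsf b^\rightarrow$, $f_iT$ replaces $i$ by $i+1$ in $\mathsf b$, else removes $i$ from $\mathsf b^\rightarrow$ and adds $i+1$ to $\mathsf b$. If no $-$ remains, $e_iT=0$; otherwise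 let $\mathsf b$ be the box containing $i+1$ in the column of the leftmost remaining $-$ and $\mathsf b^\leftarrow$ the box immediately left; if $i+1\notin\mathsf b^\leftarrow$, $e_iT$ replaces $i+1$ by $i$ in $\mathsf b$, else removes $i+1$ from $\mathsf b^\leftarrow$ and adds $i$ to $\mathsf b$. For $g\in\{e_i,e_i^K\}$, $g^{\max}T=g^rT$ with $r$ maximal such that $g^rT\ne0$. For $w\in S_3$ with reduced expression $w=s_{i_1}\cdots s_{i_\ell}$, $\mathrm{SVT}^3_w(\lambda)=\{T:(e^K_{i_\ell})^{\max}e_{i_\ell}^{\max}\cdots(e^K_{i_1})^{\max}e_{i_1}^{\max}T=u\}$ (rightmost applied first). Properties: (K.1) the graph with edges $T\to f_iT$, $T\to f_i^KT$ is connected and $u$ is the only element with $e_iu=e_i^Ku=0$ for all $i$; (K.2) $\mathrm{SVT}^3_w(\lambda)$ is independent of the reduced expression of $w$ for every $w\in S_3$; (K.3) for every $w$ and reduced expression $s_{i_1}\cdots s_{i_\ell}$, $\sum_{T\in\mathrm{SVT}^3_w(\lambda)}\beta^{\mathrm{ex}(T)}x^{\mathrm{wt}(T)}=\varpi_{i_1}\cdots\varpi_{i_\ell}x_1^2x_2$ (the Lascoux polynomial $L_{w\lambda}$), where $\partial_if=(f-s_if)/(x_i-x_{i+1})$ and $\varpi_if=\partial_i((x_i+\beta x_ix_{i+1})f)$. -}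

module Defs where

open import Data.Bool using (Bool; true; false; _∧_; _∨_; not; if_then_else_; T)
open import Data.Nat as ℕ using (ℕ; zero; suc; _≤ᵇ_; _<ᵇ_; _≡ᵇ_)
open import Data.Integer as ℤ using (ℤ; +_)
open import Data.Fin using (Fin; zero; suc; inject₁)
open import Data.Product using (Σ; _×_; _,_; ∃)
open import Data.Sum using (_⊎_)
open import Data.Maybe using (Maybe; just; nothing; _>>=_)
open import Data.List using (List; []; _∷_; _++_; map; concatMap; foldr; length)
open import Data.Vec using (Vec; tabulate)
open import Data.Unit using (⊤; tt)
open import Relation.Binary.PropositionalEquality using (_≡_; _≢_; subst; sym)
open import Relation.Binary.Construct.Closure.ReflexiveTransitive using (Star)
open import Relation.Binary.Construct.Closure.Symmetric using (SymClosure)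
open import Data.List.Membership.Propositional using (_∈_)
open import Data.List.Relation.Unary.Unique.Propositional using (Unique)
open import Function.Bundles using (_⇔_)

-- Entries.  An entry j : Fin 3 stands for the integer j+1 ∈ {1,2,3}.
-- A crystal index i : Fin 2 stands for i+1 ∈ {1,2}; its letters are
-- "i" = lo i and "i+1" = hi i.

lo : Fin 2 → Fin 3
lo = inject₁

hi : Fin 2 → Fin 3
hi = suc

record Box : Set where
  constructor box
  field
    has1 has2 has3 : Bool

mem : Fin 3 → Box → Bool
mem zero          b = Box.has1 b
mem (suc zero)    b = Box.has2 b
mem (suc (suc zero)) b = Box.has3 b

set : Fin 3 → Bool → Box → Box
set zero             v (box x y z) = box v y z
set (suc zero)       v (box x y z) = box x v z
set (suc (suc zero)) v (box x y z) = box x y v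

insert : Fin 3 → Box → Box
insert k = set k true

remove : Fin 3 → Box → Box
remove k = set k false

nonempty : Box → Bool
nonempty (box x y z) = x ∨ y ∨ z

size : Box → ℕ
size (box x y z) = c x ℕ.+ c y ℕ.+ c z
  where c : Bool → ℕ
        c true = 1
        c false = 0

-- Fillings of the shape λ = (2,1) (English convention):
--   first row  : p11 p12
--   second row : p21

data Pos : Set where
  p11 p12 p21 : Pos

record Raw : Set where
  constructor raw
  field
    b11 b12 b21 : Box

at : Raw → Pos → Box
at (raw a b c) p11 = a
at (raw a b c) p12 = b
at (raw a b c) p21 = c

update : Pos → (Box → Box) → Raw → Raw
update p11 g (raw a b c) = raw (g a) b c
update p12 g (raw a b c) = raw a (g b) c
update p21 g (raw a b c) = raw a b (g c)

entries : List (Fin 3)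
entries = zero ∷ suc zero ∷ suc (suc zero) ∷ []

all : {A : Set} → (A → Bool) → List A → Bool
all p = foldr (λ x r → p x ∧ r) true

toℕ3 : Fin 3 → ℕ
toℕ3 zero = 0
toℕ3 (suc zero) = 1
toℕ3 (suc (suc zero)) = 2

-- every choice x ∈ A11, y ∈ A12, z ∈ A21 is a semistandard tableau:
-- x ≤ y (row weakly increasing) and x < z (column strictly increasing)
everyChoiceSSYT : Raw → Bool
everyChoiceSSYT (raw a b c) =
  all (λ x → all (λ y → all (λ z →
     not (mem x a ∧ mem y b ∧ mem z c)
       ∨ ((toℕ3 x ≤ᵇ toℕ3 y) ∧ (toℕ3 x <ᵇ toℕ3 z)))
     entries) entries) entries

validSVT : Raw → Bool
validSVT r@(raw a b c) = nonempty a ∧ nonempty b ∧ nonempty c ∧ everyChoiceSSYT r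

SVT : Set
SVT = Σ Raw (λ r → T (validSVT r))

mkSVT : Raw → Maybe SVT
mkSVT r with validSVT r in eq
... | true  = just (r , subst T (sym eq) tt)
... | false = nothing

u : SVT
u = raw (box true false false) (box true false false) (box false true false) , _

wt : SVT → ℕ × ℕ × ℕ
wt (raw a b c , _) = cnt zero , cnt (suc zero) , cnt (suc (suc zero))
  where
    c1 : Bool → ℕ
    c1 true = 1
    c1 false = 0
    cnt : Fin 3 → ℕ
    cnt j = c1 (mem j a) ℕ.+ c1 (mem j b) ℕ.+ c1 (mem j c)

ex : SVT → ℕ
ex (raw a b c , _) = (size a ℕ.∸ 1) ℕ.+ (size b ℕ.∸ 1) ℕ.+ (size c ℕ.∸ 1)

-- The fixed crystal operators e_i, f_i (signature rule on columns).

data Col : Set where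
  col1 col2 : Col

colPos : Col → List Pos
colPos col1 = p11 ∷ p21 ∷ []
colPos col2 = p12 ∷ []

columns : List Col
columns = col1 ∷ col2 ∷ []

any : {A : Set} → (A → Bool) → List A → Bool
any p = foldr (λ x r → p x ∨ r) false

colHas : Raw → Col → Fin 3 → Bool
colHas r c k = any (λ p → mem k (at r p)) (colPos c)

data Sign : Set where
  plus minus : Sign

signOf : Fin 2 → Raw → Col → Maybe Sign
signOf i r c with colHas r c (lo i) | colHas r c (hi i)
... | true  | false = just plus
... | false | true  = just minus
... | _     | _     = nothing

signWord : Fin 2 → Raw → List (Col × Sign)
signWord i r = go columns
  where
    go : List Col → List (Col × Sign)
    go [] = []
    go (c ∷ cs) with signOf i r c
    ... | just s  = (c , s) ∷ go cs
    ... | nothing = go cs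

delPair : List (Col × Sign) → Maybe (List (Col × Sign))
delPair ((c , minus) ∷ (c' , plus) ∷ rest) = just rest
delPair (x ∷ rest) = Data.Maybe.map (x ∷_) (delPair rest)
delPair [] = nothing

-- repeatedly delete adjacent pairs  - +  (fuel = length suffices)
reduceWith : ℕ → List (Col × Sign) → List (Col × Sign)
reduceWith zero w = w
reduceWith (suc n) w with delPair w
... | just w' = reduceWith n w'
... | nothing = w

reduced : List (Col × Sign) → List (Col × Sign)
reduced w = reduceWith (length w) w

rightmostPlus : List (Col × Sign) → Maybe Col
rightmostPlus [] = nothing
rightmostPlus ((c , s) ∷ w) with rightmostPlus w
... | just c' = just c'
... | nothing with s
...   | plus  = just c
...   | minus = nothing

leftmostMinus : List (Col × Sign) → Maybe Col
leftmostMinus [] = nothing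
leftmostMinus ((c , minus) ∷ w) = just c
leftmostMinus ((c , plus) ∷ w) = leftmostMinus w

boxIn : Raw → Col → Fin 3 → Pos
boxIn r col1 k = if mem k (at r p11) then p11 else p21
boxIn r col2 k = p12

rightOf : Pos → Maybe Pos
rightOf p11 = just p12
rightOf p12 = nothing
rightOf p21 = nothing

leftOf : Pos → Maybe Pos
leftOf p11 = nothing
leftOf p12 = just p11
leftOf p21 = nothing

memAt : Raw → Maybe Pos → Fin 3 → Bool
memAt r nothing  k = false
memAt r (just q) k = mem k (at r q)

fRaw : Fin 2 → Raw → Col → Raw
fRaw i r c with boxIn r c (lo i) | rightOf (boxIn r c (lo i))
... | p | just q = if mem (lo i) (at r q)
                     then update p (insert (hi i)) (update q (remove (lo i)) r)
                     else update p (insert (hi i) ∘' remove (lo i)) r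
  where _∘'_ : (Box → Box) → (Box → Box) → Box → Box
        (g ∘' h) x = g (h x)
... | p | nothing = update p (λ x → insert (hi i) (remove (lo i) x)) r

eRaw : Fin 2 → Raw → Col → Raw
eRaw i r c with boxIn r c (hi i) | leftOf (boxIn r c (hi i))
... | p | just q = if mem (hi i) (at r q)
                     then update p (insert (lo i)) (update q (remove (hi i)) r)
                     else update p (λ x → insert (lo i) (remove (hi i) x)) r
... | p | nothing = update p (λ x → insert (lo i) (remove (hi i) x)) r

-- (mkSVT never returns nothing here: the operators preserve SVT^3(λ))
f : Fin 2 → SVT → Maybe SVT
f i (r , _) with rightmostPlus (reduced (signWord i r))
... | nothing = nothing
... | just c  = mkSVT (fRaw i r c)

e : Fin 2 → SVT → Maybe SVT
e i (r , _) with leftmostMinus (reduced (signWord i r))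
... | nothing = nothing
... | just c  = mkSVT (eRaw i r c)

-- g^max as a relation:  GMax g T T'  iff  T' = g^r T with r maximal
-- such that g^r T ≠ 0 (i.e. g^r T = T' and g T' = 0).

iter : (SVT → Maybe SVT) → ℕ → SVT → Maybe SVT
iter g zero    t = just t
iter g (suc r) t = iter g r t >>= g

GMax : (SVT → Maybe SVT) → SVT → SVT → Set
GMax g t t' = Σ ℕ λ r → (iter g r t ≡ just t') × (g t' ≡ nothing)

Op : Set
Op = Fin 2 → SVT → Maybe SVT

-- A word  s_{i1} ... s_{il}  is the list  i1 ∷ ... ∷ il ∷ [].
-- Run eK w T T' : T' = (eK_{il})^max e_{il}^max ... (eK_{i1})^max e_{i1}^max T
Run : Op → List (Fin 2) → SVT → SVT → Set
Run eK []      t t' = t ≡ t'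
Run eK (i ∷ w) t t' =
  Σ SVT λ t₁ → Σ SVT λ t₂ → GMax (e i) t t₁ × GMax (eK i) t₁ t₂ × Run eK w t₂ t'

InSVTw : Op → List (Fin 2) → SVT → Set
InSVTw eK w t = Run eK w t u

sref : Fin 2 → Fin 3 → Fin 3
sref zero       zero             = suc zero
sref zero       (suc zero)       = zero
sref zero       (suc (suc zero)) = suc (suc zero)
sref (suc zero) zero             = zero
sref (suc zero) (suc zero)       = suc (suc zero)
sref (suc zero) (suc (suc zero)) = suc zero

act : List (Fin 2) → Fin 3 → Fin 3
act []      x = x
act (i ∷ w) x = sref i (act w x)

perm : List (Fin 2) → Vec (Fin 3) 3
perm w = tabulate (act w)

Reduced : List (Fin 2) → Set
Reduced w = ∀ w' → perm w' ≡ perm w → length w ℕ.≤ length w'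

-- Polynomials in β, x1, x2, x3 with integer coefficients, as lists of
-- terms; two polynomials are equal iff all coefficients agree.

record Mono : Set where
  constructor mono
  field
    eβ e1 e2 e3 : ℕ

Term : Set
Term = ℤ × Mono

Poly : Set
Poly = List Term

eqMono : Mono → Mono → Bool
eqMono (mono a b c d) (mono a' b' c' d') =
  (a ≡ᵇ a') ∧ (b ≡ᵇ b') ∧ (c ≡ᵇ c') ∧ (d ≡ᵇ d')

coeff : Poly → Mono → ℤ
coeff []            m = + 0
coeff ((c , m') ∷ p) m = (if eqMono m' m then c else + 0) ℤ.+ coeff p m

_≈ₚ_ : Poly → Poly → Set
p ≈ₚ q = ∀ m → coeff p m ≡ coeff q m

mulMono : Mono → Mono → Mono
mulMono (mono a b c d) (mono a' b' c' d') =
  mono (a ℕ.+ a') (b ℕ.+ b') (c ℕ.+ c') (d ℕ.+ d')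

_*ₚ_ : Poly → Poly → Poly
p *ₚ q = concatMap (λ { (c , m) → map (λ { (c' , m') → (c ℤ.* c' , mulMono m m') }) q }) p

_+ₚ_ : Poly → Poly → Poly
p +ₚ q = p ++ q

getX : Fin 3 → Mono → ℕ
getX zero             (mono a b c d) = b
getX (suc zero)       (mono a b c d) = c
getX (suc (suc zero)) (mono a b c d) = d

setX : Fin 3 → ℕ → Mono → Mono
setX zero             n (mono a b c d) = mono a n c d
setX (suc zero)       n (mono a b c d) = mono a b n d
setX (suc (suc zero)) n (mono a b c d) = mono a b c n

withXY : Fin 2 → ℕ → ℕ → Mono → Mono
withXY i p q m = setX (hi i) q (setX (lo i) p m)

sPoly : Fin 2 → Poly → Poly
sPoly i = map (λ { (c , m) → (c , withXY i (getX (hi i) m) (getX (lo i) m) m) })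

-- ∂_i on a term c·x_i^a x_{i+1}^b·(rest):  the exact quotient
--   c·(x_i^a x_{i+1}^b − x_i^b x_{i+1}^a)/(x_i − x_{i+1}) ·(rest)
--   = c·Σ_{k=b}^{a−1} x_i^k x_{i+1}^{a+b−1−k} ·(rest)          if a > b
--   = 0                                                          if a = b
--   = −c·Σ_{k=a}^{b−1} x_i^k x_{i+1}^{a+b−1−k} ·(rest)         if a < b
range : ℕ → ℕ → List ℕ
range s zero    = []
range s (suc n) = s ∷ range (suc s) n

∂term : Fin 2 → Term → Poly
∂term i (c , m) with getX (lo i) m | getX (hi i) m
... | a | b =
  if b <ᵇ a
    then map (λ k → (c , withXY i k ((a ℕ.+ b ℕ.∸ 1) ℕ.∸ k) m)) (range b (a ℕ.∸ b))
    else map (λ k → (ℤ.- c , withXY i k ((a ℕ.+ b ℕ.∸ 1) ℕ.∸ k) m)) (range a (b ℕ.∸ a))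

∂ : Fin 2 → Poly → Poly
∂ i = concatMap (∂term i)

xmono : Fin 3 → Mono
xmono j = setX j 1 (mono 0 0 0 0)

ϖ : Fin 2 → Poly → Poly
ϖ i g = ∂ i (((+ 1 , xmono (lo i)) ∷ (+ 1 , mulMono (mono 1 0 0 0) (mulMono (xmono (lo i)) (xmono (hi i)))) ∷ []) *ₚ g)

ϖword : List (Fin 2) → Poly → Poly
ϖword []      g = g
ϖword (i ∷ w) g = ϖ i (ϖword w g)

xλ : Poly
xλ = (+ 1 , mono 0 2 1 0) ∷ []

genPoly : List SVT → Poly
genPoly = map (λ t → (+ 1 , term t))
  where
    term : SVT → Mono
    term t with wt t
    ... | (c1 , c2 , c3) = mono (ex t) c1 c2 c3

AddsEntry : Fin 3 → SVT → SVT → Set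
AddsEntry k (r , _) (r' , _) =
  Σ Pos λ p → (mem k (at r p) ≡ false)
            × (at r' p ≡ insert k (at r p))
            × (∀ q → q ≢ p → at r' q ≡ at r q)

AddProp : Op → Set
AddProp fK = ∀ i t t' → fK i t ≡ just t' → AddsEntry (hi i) t t'

InvProp : Op → Op → Set
InvProp eK fK = ∀ i t t' → (eK i t' ≡ just t) ⇔ (fK i t ≡ just t')

Edge : Op → SVT → SVT → Set
Edge fK t t' = Σ (Fin 2) λ i → (f i t ≡ just t') ⊎ (fK i t ≡ just t')

K1 : Op → Op → Set
K1 eK fK =
  (∀ t t' → Star (SymClosure (Edge fK)) t t')
  × (∀ i → (e i u ≡ nothing) × (eK i u ≡ nothing))
  × (∀ t → (∀ i → (e i t ≡ nothing) × (eK i t ≡ nothing)) → t ≡ u)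

K2 : Op → Set
K2 eK = ∀ w w' → Reduced w → Reduced w' → perm w ≡ perm w' →
        ∀ t → InSVTw eK w t ⇔ InSVTw eK w' t

K3 : Op → Set
K3 eK = ∀ w → Reduced w →
        Σ (List SVT) λ L → Unique L
          × (∀ t → (t ∈ L) ⇔ InSVTw eK w t)
          × (genPoly L ≈ₚ ϖword w xλ)

H2 : Op → Set
H2 fK = ∀ i t → ((e i t ≢ nothing) ⊎ (f i t ≡ nothing)) → fK i t ≡ nothing

Good : Op → Op → Set
Good eK fK = AddProp fK × InvProp eK fK × K1 eK fK × K2 eK × K3 eK × H2 fK

-- Suppose eᴷ, fᴷ were such operators.  The key observation: if fᴷᵢ x = s,
-- then x is s with one entry i+1 deleted (the addition rule).  Such an x is
-- called a `Source` of s; for each of the few tableaux s needed below the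
-- sources are found by trying the three boxes, and there is at most one.
--
-- Inside the module
-- `Refutation`: (K.1) says that a tableau s ≠ u killed by e₁ and e₂ has an
-- eᴷ-predecessor, which with the source analysis forces three values of fᴷ;
-- (K.2) for the braid relation, with determinism, says that no tableau is
-- lowered to u along one braid word and to some c ≠ u along the other.
-- Running both words on (12,3|3), (1,3|23) and (1,23|2) then refutes each
-- possibility for eᴷ₁(12,3|3) and eᴷ₂(1,2|23).  In fact neither (K.3) nor
-- (H.2) is needed: the addition rule, the inverse property, (K.1) and (K.2)
-- are already contradictory.

module Submission where

open import Defs
open import Relation.Nullary using (¬_)
open import Data.Bool using (true; false)
open import Data.Nat using (zero; suc; z≤n; s≤s)
open import Data.Fin using (Fin; zero; suc)
open import Data.Product using (Σ; _,_; proj₁; proj₂)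
open import Data.Maybe using (Maybe; just; nothing; _>>=_)
open import Data.Maybe.Properties using (just-injective)
open import Data.List using (List; []; _∷_)
open import Data.Empty using (⊥; ⊥-elim)
open import Data.Unit using (tt)
open import Relation.Binary.PropositionalEquality
  using (_≡_; refl; sym; trans; cong; subst; _≢_)
open import Function.Bundles using (Equivalence)

iter-suc : ∀ (g : SVT → Maybe SVT) r t → iter g (suc r) t ≡ (g t >>= iter g r)
iter-suc g zero t with g t
... | nothing = refl
... | just _  = refl
iter-suc g (suc r) t rewrite iter-suc g r t with g t
... | nothing = refl
... | just _  = refl

iter-stuck : ∀ g r {t} → g t ≡ nothing → iter g (suc r) t ≡ nothing
iter-stuck g r {t} dead = trans (iter-suc g r t) (cong (_>>= iter g r) dead)

iter-step : ∀ g r {t t′} → g t ≡ just t′ → iter g (suc r) t ≡ iter g r t′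
iter-step g r {t} step = trans (iter-suc g r t) (cong (_>>= iter g r) step)

maximal-iterates-agree : ∀ g r s {t a b} → iter g r t ≡ just a → g a ≡ nothing →
                         iter g s t ≡ just b → g b ≡ nothing → a ≡ b
maximal-iterates-agree g zero zero refl _ refl _ = refl
maximal-iterates-agree g zero (suc s) refl dead reach _
  with () ← trans (sym reach) (iter-stuck g s dead)
maximal-iterates-agree g (suc r) zero reach _ refl dead
  with () ← trans (sym reach) (iter-stuck g r dead)
maximal-iterates-agree g (suc r) (suc s) {t} reach ga reach′ gb with g t in step
... | just _  = maximal-iterates-agree g r s (trans (sym (iter-step g r step)) reach) ga
                                             (trans (sym (iter-step g s step)) reach′) gb
... | nothing with () ← trans (sym reach) (iter-stuck g r step)

gmax-unique : ∀ {g t a b} → GMax g t a → GMax g t b → a ≡ b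
gmax-unique {g} (r , reach , ga) (s , reach′ , gb) =
  maximal-iterates-agree g r s reach ga reach′ gb

run-unique : ∀ eK w {t a b} → Run eK w t a → Run eK w t b → a ≡ b
run-unique eK []      p q = trans (sym p) q
run-unique eK (i ∷ w) (_ , _ , G , H , R) (_ , _ , G′ , H′ , R′)
  with refl ← gmax-unique G G′ with refl ← gmax-unique H H′ = run-unique eK w R R′

gmax-now : ∀ {g t} → g t ≡ nothing → GMax g t t
gmax-now dead = zero , refl , dead

gmax-once : ∀ {g t t′} → g t ≡ just t′ → g t′ ≡ nothing → GMax g t t′
gmax-once step dead = suc zero , step , dead

w121 w212 : List (Fin 2)
w121 = zero ∷ suc zero ∷ zero ∷ []
w212 = suc zero ∷ zero ∷ suc zero ∷ []

-- No word of length ≤ 2 represents the longest permutation.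
reduced-121 : Reduced w121
reduced-121 [] ()
reduced-121 (zero ∷ []) ()
reduced-121 (suc zero ∷ []) ()
reduced-121 (zero ∷ zero ∷ []) ()
reduced-121 (zero ∷ suc zero ∷ []) ()
reduced-121 (suc zero ∷ zero ∷ []) ()
reduced-121 (suc zero ∷ suc zero ∷ []) ()
reduced-121 (_ ∷ _ ∷ _ ∷ _) _ = s≤s (s≤s (s≤s z≤n))

-- Both words represent the same permutation, so this is the same fact.
reduced-212 : Reduced w212
reduced-212 w′ same = reduced-121 w′ same

mem-insert : ∀ k b → mem k (insert k b) ≡ true
mem-insert zero             _ = refl
mem-insert (suc zero)       _ = refl
mem-insert (suc (suc zero)) _ = refl

remove-insert : ∀ k b → mem k b ≡ false → remove k (insert k b) ≡ b
remove-insert zero             (box false _ _) refl = refl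
remove-insert (suc zero)       (box _ false _) refl = refl
remove-insert (suc (suc zero)) (box _ _ false) refl = refl

undo-add : ∀ k p {r r′} → mem k (at r p) ≡ false → at r′ p ≡ insert k (at r p) →
           (∀ q → q ≢ p → at r′ q ≡ at r q) → r ≡ update p (remove k) r′
undo-add k p11 {raw a b c} fresh refl same
  rewrite same p12 (λ ()) | same p21 (λ ()) | remove-insert k a fresh = refl
undo-add k p12 {raw a b c} fresh refl same
  rewrite same p11 (λ ()) | same p21 (λ ()) | remove-insert k b fresh = refl
undo-add k p21 {raw a b c} fresh refl same
  rewrite same p11 (λ ()) | same p12 (λ ()) | remove-insert k c fresh = refl

record Source (i : Fin 2) (x s : SVT) : Set where
  field
    position : Pos
    occurs   : mem (hi i) (at (proj₁ s) position) ≡ true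
    removes  : proj₁ x ≡ update position (remove (hi i)) (proj₁ s)

-- The tableaux involved.  t<A>-<B>-<C> has first row A, B and second row C.

b1 b2 b3 b12 b13 b23 : Box
b1  = box true  false false
b2  = box false true  false
b3  = box false false true
b12 = box true  true  false
b13 = box true  false true
b23 = box false true  true

t1-1-3 t1-1-23 t1-12-2 t1-12-3 t1-13-2 t1-2-2 t1-2-23 t1-23-2
  t1-3-3 t1-3-23 t12-2-3 t12-3-3 : SVT
t1-1-3  = raw b1  b1  b3  , tt
t1-1-23 = raw b1  b1  b23 , tt
t1-12-2 = raw b1  b12 b2  , tt
t1-12-3 = raw b1  b12 b3  , tt
t1-13-2 = raw b1  b13 b2  , tt
t1-2-2  = raw b1  b2  b2  , tt
t1-2-23 = raw b1  b2  b23 , tt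
t1-23-2 = raw b1  b23 b2  , tt
t1-3-3  = raw b1  b3  b3  , tt
t1-3-23 = raw b1  b3  b23 , tt
t12-2-3 = raw b12 b2  b3  , tt
t12-3-3 = raw b12 b3  b3  , tt

-- Sources of these tableaux, found by trying the three boxes: each box
-- either lacks the entry i+1, or becomes empty when it is deleted, or
-- yields the unique source.

source₁-t1-12-3 : ∀ {x} → Source zero x t1-12-3 → x ≡ t1-1-3
source₁-t1-12-3 record { position = p11 ; occurs = () }
source₁-t1-12-3 record { position = p21 ; occurs = () }
source₁-t1-12-3 {_ , _} record { position = p12 ; removes = refl } = refl

source₂-t1-12-3 : ∀ {x} → ¬ Source (suc zero) x t1-12-3
source₂-t1-12-3 record { position = p11 ; occurs = () }
source₂-t1-12-3 record { position = p12 ; occurs = () }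
source₂-t1-12-3 {_ , ()} record { position = p21 ; removes = refl }

source₁-t1-1-23 : ∀ {x} → Source zero x t1-1-23 → x ≡ t1-1-3
source₁-t1-1-23 record { position = p11 ; occurs = () }
source₁-t1-1-23 record { position = p12 ; occurs = () }
source₁-t1-1-23 {_ , _} record { position = p21 ; removes = refl } = refl

source₂-t1-1-23 : ∀ {x} → Source (suc zero) x t1-1-23 → x ≡ u
source₂-t1-1-23 record { position = p11 ; occurs = () }
source₂-t1-1-23 record { position = p12 ; occurs = () }
source₂-t1-1-23 {_ , _} record { position = p21 ; removes = refl } = refl

source₁-t1-12-2 : ∀ {x} → Source zero x t1-12-2 → x ≡ u
source₁-t1-12-2 record { position = p11 ; occurs = () }
source₁-t1-12-2 {_ , _} record { position = p12 ; removes = refl } = refl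
source₁-t1-12-2 {_ , ()} record { position = p21 ; removes = refl }

source₂-t1-12-2 : ∀ {x} → ¬ Source (suc zero) x t1-12-2
source₂-t1-12-2 record { position = p11 ; occurs = () }
source₂-t1-12-2 record { position = p12 ; occurs = () }
source₂-t1-12-2 record { position = p21 ; occurs = () }

source₂-t12-2-3 : ∀ {x} → ¬ Source (suc zero) x t12-2-3
source₂-t12-2-3 record { position = p11 ; occurs = () }
source₂-t12-2-3 record { position = p12 ; occurs = () }
source₂-t12-2-3 {_ , ()} record { position = p21 ; removes = refl }

source₁-t1-1-3 : ∀ {x} → ¬ Source zero x t1-1-3
source₁-t1-1-3 record { position = p11 ; occurs = () }
source₁-t1-1-3 record { position = p12 ; occurs = () }
source₁-t1-1-3 record { position = p21 ; occurs = () }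

source₁-t12-3-3 : ∀ {x} → Source zero x t12-3-3 → x ≡ t1-3-3
source₁-t12-3-3 {_ , _} record { position = p11 ; removes = refl } = refl
source₁-t12-3-3 record { position = p12 ; occurs = () }
source₁-t12-3-3 record { position = p21 ; occurs = () }

source₁-t1-3-23 : ∀ {x} → Source zero x t1-3-23 → x ≡ t1-3-3
source₁-t1-3-23 record { position = p11 ; occurs = () }
source₁-t1-3-23 record { position = p12 ; occurs = () }
source₁-t1-3-23 {_ , _} record { position = p21 ; removes = refl } = refl

source₂-t1-2-23 : ∀ {x} → Source (suc zero) x t1-2-23 → x ≡ t1-2-2
source₂-t1-2-23 record { position = p11 ; occurs = () }
source₂-t1-2-23 record { position = p12 ; occurs = () }
source₂-t1-2-23 {_ , _} record { position = p21 ; removes = refl } = refl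

source₁-t1-13-2 : ∀ {x} → ¬ Source zero x t1-13-2
source₁-t1-13-2 record { position = p11 ; occurs = () }
source₁-t1-13-2 record { position = p12 ; occurs = () }
source₁-t1-13-2 {_ , ()} record { position = p21 ; removes = refl }

source₂-t1-23-2 : ∀ {x} → Source (suc zero) x t1-23-2 → x ≡ t1-2-2
source₂-t1-23-2 record { position = p11 ; occurs = () }
source₂-t1-23-2 {_ , _} record { position = p12 ; removes = refl } = refl
source₂-t1-23-2 record { position = p21 ; occurs = () }

module Refutation (eK fK : Op) (good : Good eK fK) where
  open Equivalence

  addition : AddProp fK
  addition = proj₁ good

  inverse : InvProp eK fK
  inverse = proj₁ (proj₂ good)

  k1 : K1 eK fK
  k1 = proj₁ (proj₂ (proj₂ good))

  k2 : K2 eK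
  k2 = proj₁ (proj₂ (proj₂ (proj₂ good)))

  fK-of-eK : ∀ {i x s} → eK i s ≡ just x → fK i x ≡ just s
  fK-of-eK {i} {x} {s} = to (inverse i x s)

  eK-of-fK : ∀ {i x s} → fK i x ≡ just s → eK i s ≡ just x
  eK-of-fK {i} {x} {s} = from (inverse i x s)

  source : ∀ {i x s} → fK i x ≡ just s → Source i x s
  source {i} {x} {s} edge with addition i x s edge
  ... | p , fresh , grown , same = record
    { position = p
    ; occurs   = subst (λ b → mem (hi i) b ≡ true) (sym grown) (mem-insert (hi i) _)
    ; removes  = undo-add (hi i) p fresh grown same
    }

  eK-dead : ∀ {i s} → (∀ {x} → fK i x ≡ just s → ⊥) → eK i s ≡ nothing
  eK-dead {i} {s} no-edge with eK i s in lowering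
  ... | nothing = refl
  ... | just _  = ⊥-elim (no-edge (fK-of-eK lowering))

  eK-dead-unsourced : ∀ {i s} → (∀ {x} → ¬ Source i x s) → eK i s ≡ nothing
  eK-dead-unsourced none = eK-dead λ edge → none (source edge)

  edge-from : ∀ {i x y s} → (∀ {x′} → Source i x′ s → x′ ≡ y) →
              fK i x ≡ just s → fK i y ≡ just s
  edge-from {i} {s = s} only edge = subst (λ z → fK i z ≡ just s) (only (source edge)) edge

  eK-dead-elsewhere : ∀ {i s y s′} → (∀ {x} → Source i x s → x ≡ y) →
                      fK i y ≡ just s′ → s′ ≢ s → eK i s ≡ nothing
  eK-dead-elsewhere only sent differ =
    eK-dead λ edge → differ (just-injective (trans (sym sent) (edge-from only edge)))

  has-predecessor : ∀ s → s ≢ u → e zero s ≡ nothing → e (suc zero) s ≡ nothing →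
                    Σ (Fin 2) λ i → Σ SVT λ x → fK i x ≡ just s
  has-predecessor s s≢u e₁-dead e₂-dead
    with eK zero s in lower₁ | eK (suc zero) s in lower₂
  ... | just x  | _       = zero , x , fK-of-eK lower₁
  ... | nothing | just x  = suc zero , x , fK-of-eK lower₂
  ... | nothing | nothing =
    ⊥-elim (s≢u (proj₂ (proj₂ k1) s λ { zero → e₁-dead , lower₁ ; (suc zero) → e₂-dead , lower₂ }))

  eK-u : ∀ i → eK i u ≡ nothing
  eK-u i = proj₂ (proj₁ (proj₂ k1) i)

  braid-121 : ∀ {t c} → Run eK w121 t c → c ≢ u → ¬ Run eK w212 t u
  braid-121 {t} R c≢u R′ =
    c≢u (run-unique eK w121 R (from (k2 w121 w212 reduced-121 reduced-212 refl t) R′))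

  braid-212 : ∀ {t c} → Run eK w212 t c → c ≢ u → ¬ Run eK w121 t u
  braid-212 {t} R c≢u R′ =
    c≢u (run-unique eK w212 R (to (k2 w121 w212 reduced-121 reduced-212 refl t) R′))

  -- Values of fᴷ forced by (K.1).
  fK₁-t1-1-3 : fK zero t1-1-3 ≡ just t1-12-3
  fK₁-t1-1-3 with has-predecessor t1-12-3 (λ ()) refl refl
  ... | zero , x , edge = edge-from source₁-t1-12-3 edge
  ... | suc zero , x , edge = ⊥-elim (source₂-t1-12-3 (source edge))

  fK₂-u : fK (suc zero) u ≡ just t1-1-23
  fK₂-u with has-predecessor t1-1-23 (λ ()) refl refl
  ... | suc zero , x , edge = edge-from source₂-t1-1-23 edge
  ... | zero , x , edge
    with () ← trans (sym fK₁-t1-1-3) (edge-from source₁-t1-1-23 edge)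

  fK₁-u : fK zero u ≡ just t1-12-2
  fK₁-u with has-predecessor t1-12-2 (λ ()) refl refl
  ... | zero , x , edge = edge-from source₁-t1-12-2 edge
  ... | suc zero , x , edge = ⊥-elim (source₂-t1-12-2 (source edge))

  -- (12,3|3) must have an eᴷ₁-predecessor: otherwise s₂s₁s₂ lowers it to u
  -- while s₁s₂s₁ stops at (1,1|3).
  eK₁-t12-3-3-alive : ¬ (eK zero t12-3-3 ≡ nothing)
  eK₁-t12-3-3-alive dead = braid-121 lower-121 (λ ()) lower-212
    where
      dead₂-t12-2-3 : eK (suc zero) t12-2-3 ≡ nothing
      dead₂-t12-2-3 = eK-dead-unsourced source₂-t12-2-3
      dead₁-t1-1-3 : eK zero t1-1-3 ≡ nothing
      dead₁-t1-1-3 = eK-dead-unsourced source₁-t1-1-3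
      lower-121 : Run eK w121 t12-3-3 t1-1-3
      lower-121 = t12-3-3 , t12-3-3 , gmax-now refl , gmax-now dead ,
                  t12-2-3 , t12-2-3 , gmax-once refl refl , gmax-now dead₂-t12-2-3 ,
                  t1-12-3 , t1-1-3 , gmax-once refl refl , gmax-once (eK-of-fK fK₁-t1-1-3) dead₁-t1-1-3 ,
                  refl
      lower-212 : Run eK w212 t12-3-3 u
      lower-212 = t12-2-3 , t12-2-3 , gmax-once refl refl , gmax-now dead₂-t12-2-3 ,
                  t1-12-3 , t1-1-3 , gmax-once refl refl , gmax-once (eK-of-fK fK₁-t1-1-3) dead₁-t1-1-3 ,
                  u , u , gmax-once refl refl , gmax-now (eK-u (suc zero)) ,
                  refl

  -- Given fᴷ₁(1,3|3) = (12,3|3), (1,2|23) must have an eᴷ₂-predecessor: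
  -- otherwise s₂s₁s₂ lowers (1,3|23) to u while s₁s₂s₁ stops at (1,1|23).
  eK₂-t1-2-23-alive : fK zero t1-3-3 ≡ just t12-3-3 → ¬ (eK (suc zero) t1-2-23 ≡ nothing)
  eK₂-t1-2-23-alive sent dead = braid-121 lower-121 (λ ()) lower-212
    where
      dead₁-t1-3-23 : eK zero t1-3-23 ≡ nothing
      dead₁-t1-3-23 = eK-dead-elsewhere source₁-t1-3-23 sent (λ ())
      dead₁-t1-1-23 : eK zero t1-1-23 ≡ nothing
      dead₁-t1-1-23 = eK-dead-elsewhere source₁-t1-1-23 fK₁-t1-1-3 (λ ())
      lower-121 : Run eK w121 t1-3-23 t1-1-23
      lower-121 = t1-3-23 , t1-3-23 , gmax-now refl , gmax-now dead₁-t1-3-23 ,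
                  t1-2-23 , t1-2-23 , gmax-once refl refl , gmax-now dead ,
                  t1-1-23 , t1-1-23 , gmax-once refl refl , gmax-now dead₁-t1-1-23 ,
                  refl
      lower-212 : Run eK w212 t1-3-23 u
      lower-212 = t1-2-23 , t1-2-23 , gmax-once refl refl , gmax-now dead ,
                  t1-1-23 , t1-1-23 , gmax-once refl refl , gmax-now dead₁-t1-1-23 ,
                  t1-1-23 , u , gmax-now refl , gmax-once (eK-of-fK fK₂-u) (eK-u (suc zero)) ,
                  refl

  -- fᴷ₂(1,2|2) = (1,2|23) is impossible: s₁s₂s₁ would lower (1,23|2) to u
  -- while s₂s₁s₂ stops at (1,12|2).
  fK₂-t1-2-2-not-t1-2-23 : ¬ (fK (suc zero) t1-2-2 ≡ just t1-2-23)
  fK₂-t1-2-2-not-t1-2-23 sent = braid-212 lower-212 (λ ()) lower-121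
    where
      dead₁-t1-13-2 : eK zero t1-13-2 ≡ nothing
      dead₁-t1-13-2 = eK-dead-unsourced source₁-t1-13-2
      dead₂-t1-12-2 : eK (suc zero) t1-12-2 ≡ nothing
      dead₂-t1-12-2 = eK-dead-unsourced source₂-t1-12-2
      dead₂-t1-23-2 : eK (suc zero) t1-23-2 ≡ nothing
      dead₂-t1-23-2 = eK-dead-elsewhere source₂-t1-23-2 sent (λ ())
      lower-121 : Run eK w121 t1-23-2 u
      lower-121 = t1-13-2 , t1-13-2 , gmax-once refl refl , gmax-now dead₁-t1-13-2 ,
                  t1-12-2 , t1-12-2 , gmax-once refl refl , gmax-now dead₂-t1-12-2 ,
                  t1-12-2 , u , gmax-now refl , gmax-once (eK-of-fK fK₁-u) (eK-u zero) ,
                  refl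
      lower-212 : Run eK w212 t1-23-2 t1-12-2
      lower-212 = t1-23-2 , t1-23-2 , gmax-now refl , gmax-now dead₂-t1-23-2 ,
                  t1-13-2 , t1-13-2 , gmax-once refl refl , gmax-now dead₁-t1-13-2 ,
                  t1-12-2 , t1-12-2 , gmax-once refl refl , gmax-now dead₂-t1-12-2 ,
                  refl

  -- eᴷ₁(12,3|3) is forced to be (1,3|3), and then eᴷ₂(1,2|23) is forced to
  -- be (1,2|2), which is impossible.
  absurd : ⊥
  absurd with eK zero t12-3-3 in lower₁ | eK (suc zero) t1-2-23 in lower₂
  ... | nothing | _       = eK₁-t12-3-3-alive lower₁
  ... | just _  | nothing =
    eK₂-t1-2-23-alive (edge-from source₁-t12-3-3 (fK-of-eK lower₁)) lower₂
  ... | just _  | just _  =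
    fK₂-t1-2-2-not-t1-2-23 (edge-from source₂-t1-2-23 (fK-of-eK lower₂))

proposition7p11 : (eK fK : Op) → ¬ Good eK fK
proposition7p11 eK fK good = Refutation.absurd eK fK good
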